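{- Fix any correct collect algorithm $A^*$ and an execution of it. Let $t_2=t_1+n-1$ and suppose exactly $m$ processes carry out at least one step in $(t_1,t_2]$. Then $A^*$ completes at most $m$ collects during $(t_1,t_2]$.
   Context: Model: $n$ processes communicate through atomic single-writer multi-reader registers, one owned by each process; an execution is an interleaved sequence of steps, each a read or write of a single register, ordered by an adversarial schedule; time is measured by the total number of steps taken by all processes. A collect operation by a process returns a value for each of the $n$ registers; a collect algorithm is correct if in every execution every value returned by a collect is fresh, i.e., was present in the corresponding register at some time between the start and the end of that collect. Processes repeatedly perform collects. -}

module Defs where

open import Data.Nat using (ℕ; zero; suc; _+_; _∸_; _≤_; _<_)
open import Data.Fin using (Fin; _≟_)
open import Data.Bool using (Bool; if_then_else_)
open import Data.Maybe using (Maybe; just; nothing; is-just)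
open import Data.Product using (_×_; _,_; proj₁; proj₂; Σ; ∃)
open import Data.List using (List; map; upTo; allFin; filterᵇ; length)
open import Data.Bool.ListAction using (any)
open import Relation.Nullary using (¬_)
open import Relation.Nullary.Decidable using (isYes)
open import Relation.Binary.PropositionalEquality using (_≡_)

-- The content of register i is a
-- pair (value , meta): 'value : ℕ' is the value held in the register that
-- collects must return (it is changed only by the owner's store steps,
-- i.e. by the application/adversary, with arbitrary values), and 'meta' is
-- auxiliary data the collect algorithm may write into its own register.

-- The atomic operation a process performs in its next step, as a function
-- of its local state.  A step may also complete a collect, returning a value
-- for each of the n registers ('just out').
data Op (n : ℕ) (S M : Set) : Set where
  rd : Fin n → (ℕ × M → S × Maybe (Fin n → ℕ)) → Op n S M
  wr : M → S → Maybe (Fin n → ℕ) → Op n S M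

record Algorithm (n : ℕ) : Set₁ where
  field
    State   : Set
    Meta    : Set
    meta₀   : Meta
    init    : Fin n → State
    next    : Fin n → State → Op n State Meta
    -- a process observes its own store steps
    onStore : Fin n → State → ℕ → State

-- Events chosen by the adversarial schedule: a step of the algorithm by
-- process p, or a store step of p writing value v into its own register.
data Event (n : ℕ) : Set where
  step  : Fin n → Event n
  store : Fin n → ℕ → Event n

actor : ∀ {n} → Event n → Fin n
actor (step p)    = p
actor (store p _) = p

-- An execution: initial register values and an (infinite) schedule.
-- 'sched k' is the event performed by the (k+1)-st step, i.e. the step at
-- time suc k; it transforms configuration k into configuration (suc k).
record Execution (n : ℕ) : Set where
  field
    initVal : Fin n → ℕ
    sched   : ℕ → Event n

update : ∀ {n} {X : Set} → (Fin n → X) → Fin n → X → (Fin n → X)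
update f i x j = if isYes (i ≟ j) then x else f j

module _ {n : ℕ} (A : Algorithm n) where
  open Algorithm A

  record Config : Set where
    field
      st  : Fin n → State
      reg : Fin n → ℕ × Meta
  open Config

  apply : Config → Event n → Config × Maybe (Fin n → ℕ)
  apply c (store p v) =
    record { st = update (st c) p (onStore p (st c p) v)
           ; reg = update (reg c) p (v , proj₂ (reg c p)) } , nothing
  apply c (step p) with next p (st c p)
  ... | rd j k = record { st = update (st c) p (proj₁ (k (reg c j))) ; reg = reg c }
                 , proj₂ (k (reg c j))
  ... | wr m s o = record { st = update (st c) p s
                          ; reg = update (reg c) p (proj₁ (reg c p) , m) } , o

  config : Execution n → ℕ → Config
  config ex zero    = record { st = init ; reg = λ i → Execution.initVal ex i , meta₀ }
  config ex (suc k) = proj₁ (apply (config ex k) (Execution.sched ex k))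

  output : Execution n → ℕ → Maybe (Fin n → ℕ)
  output ex k = proj₂ (apply (config ex k) (Execution.sched ex k))

  value : Execution n → ℕ → Fin n → ℕ
  value ex τ q = proj₁ (reg (config ex τ) q)

  Completes : Execution n → Fin n → ℕ → (Fin n → ℕ) → Set
  Completes ex p k out = actor (Execution.sched ex k) ≡ p × output ex k ≡ just out

  -- step f is the first step of the collect of p that completes with step k:
  -- f is a step of p, no collect of p completes in steps f,…,k-1, and every
  -- earlier step of p is followed by a completion of p before f.
  IsCollectStart : Execution n → Fin n → ℕ → ℕ → Set
  IsCollectStart ex p f k =
    f ≤ k × actor (Execution.sched ex f) ≡ p
    × (∀ i → f ≤ i → i < k → ∀ o → ¬ Completes ex p i o)
    × (∀ j → j < f → actor (Execution.sched ex j) ≡ p →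
         Σ ℕ λ i → j ≤ i × i < f × ∃ λ o → Completes ex p i o)

  -- Correctness: in every execution, every value returned by a collect is
  -- fresh: it was present in the corresponding register at some time between
  -- the start of the collect (configuration f, just before its first step)
  -- and its end (configuration suc k, just after its last step).
  Correct : Set
  Correct = ∀ (ex : Execution n) p k out f → Completes ex p k out →
            IsCollectStart ex p f k →
            ∀ q → Σ ℕ λ τ → f ≤ τ × τ ≤ suc k × value ex τ q ≡ out q

  -- step indices k with lo ≤ k < hi, i.e. the steps at times in (lo , hi]
  window : ℕ → ℕ → List ℕ
  window lo hi = map (lo +_) (upTo (hi ∸ lo))

  activeCount : Execution n → ℕ → ℕ → ℕ
  activeCount ex lo hi =
    length (filterᵇ (λ p → any (λ k → isYes (actor (Execution.sched ex k) ≟ p))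
                               (window lo hi))
                    (allFin n))

  completedCount : Execution n → ℕ → ℕ → ℕ
  completedCount ex lo hi =
    length (filterᵇ (λ k → is-just (output ex k)) (window lo hi))

-- A collect of p over steps f … k depends on every process: otherwise some q has neither its state
-- nor its register in the backward dependency cone of p's final state, and inserting at time f a store
-- of a new value into q's register (redirecting q's later stores to that value) leaves p's collect
-- unchanged while making its value for q stale.  Each step adds at most one location to the cone, so a
-- collect takes at least n − 1 steps.  Hence no process completes two collects within n − 1 consecutive
-- steps, and sending each completed collect to its process is an injection into the active processes.
module Submission where

open import Defs
open import Data.Nat using (ℕ; zero; suc; pred; _+_; _∸_; _≤_; _<_; s≤s; s≤s⁻¹)
open import Data.Nat.Properties
open import Data.Fin using (Fin) renaming (_≟_ to _≟F_)
open import Data.Fin.Properties using (injective⇒≤)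
open import Data.Bool using (Bool; T; if_then_else_)
open import Data.Bool.ListAction using (any)
open import Data.Maybe using (Maybe; just; nothing; is-just)
open import Data.Product using (_×_; _,_; proj₁; proj₂; Σ; ∃)
open import Data.Sum using (_⊎_; inj₁; inj₂)
open import Data.Sum.Properties using (≡-dec)
open import Data.List using (List; []; _∷_; map; upTo; allFin; filterᵇ; length; lookup)
import Data.List.Relation.Unary.Any as Any
open import Data.List.Relation.Unary.Any using (here; there; index)
open import Data.List.Relation.Unary.Any.Properties using (lookup-index; any⁺)
import Data.List.Relation.Unary.All as All
open import Data.List.Relation.Unary.AllPairs using (_∷_)
open import Data.List.Relation.Unary.Unique.Propositional using (Unique)
open import Data.List.Relation.Unary.Unique.Propositional.Properties using (upTo⁺; allFin⁺; filter⁺)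
import Data.List.Relation.Unary.Unique.Propositional.Properties as Unique
open import Data.List.Membership.Propositional using (_∈_; _∉_)
open import Data.List.Membership.Propositional.Properties
  using (∈-lookup; ∈-map⁺; ∈-map⁻; ∈-upTo⁻; ∈-filter⁺; ∈-filter⁻; ∈-allFin)
open import Data.List.Properties using (length-map; length-tabulate)
open import Data.Empty using (⊥-elim)
open import Function using (_∘_; id)
open import Relation.Nullary using (¬_; Dec; yes; no)
open import Relation.Nullary.Decidable using (isYes; fromWitness; T?)
open import Relation.Unary using (Decidable)
open import Relation.Binary.Definitions using (DecidableEquality; tri<; tri≈; tri>)
open import Relation.Binary.PropositionalEquality

lookup-injective : ∀ {A : Set} {xs : List A} → Unique xs →
                   ∀ i j → lookup xs i ≡ lookup xs j → i ≡ j
lookup-injective (_ ∷ _)    Fin.zero    Fin.zero    _  = refl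
lookup-injective (x∉xs ∷ _) Fin.zero    (Fin.suc j) eq = ⊥-elim (All.lookup x∉xs (∈-lookup j) eq)
lookup-injective (x∉xs ∷ _) (Fin.suc i) Fin.zero    eq = ⊥-elim (All.lookup x∉xs (∈-lookup i) (sym eq))
lookup-injective (_ ∷ uniq) (Fin.suc i) (Fin.suc j) eq = cong Fin.suc (lookup-injective uniq i j eq)

length-≤-injectiveOn : ∀ {A B : Set} {xs : List A} {ys : List B} (f : A → B) → Unique xs →
                       (∀ {x} → x ∈ xs → f x ∈ ys) →
                       (∀ {x y} → x ∈ xs → y ∈ xs → f x ≡ f y → x ≡ y) →
                       length xs ≤ length ys
length-≤-injectiveOn {xs = xs} {ys} f uniq into inj = injective⇒≤ index-injective
  where
  position : Fin (length xs) → Fin (length ys)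
  position i = index (into (∈-lookup i))

  index-injective : ∀ {i j} → position i ≡ position j → i ≡ j
  index-injective {i} {j} eq = lookup-injective uniq i j (inj (∈-lookup i) (∈-lookup j) (begin
    f (lookup xs i)           ≡⟨ lookup-index (into (∈-lookup i)) ⟩
    lookup ys (position i)    ≡⟨ cong (lookup ys) eq ⟩
    lookup ys (position j)    ≡⟨ lookup-index (into (∈-lookup j)) ⟨
    f (lookup xs j)           ∎))
    where open ≡-Reasoning

module _ {P : ℕ → Set} (P? : Decidable P) where

  last-witness-below : ∀ {a b} → a < b → P a →
    Σ ℕ λ i → a ≤ i × i < b × P i × (∀ j → i < j → j < b → ¬ P j)
  last-witness-below {a} {suc b} (s≤s a≤b) pa with P? b | m≤n⇒m<n∨m≡n a≤b
  ... | yes pb | _ = b , a≤b , ≤-refl , pb , λ j b<j j<1+b → ⊥-elim (<⇒≱ b<j (s≤s⁻¹ j<1+b))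
  ... | no ¬pb | inj₂ refl = ⊥-elim (¬pb pa)
  ... | no ¬pb | inj₁ a<b with last-witness-below a<b pa
  ...   | i , a≤i , i<b , pi , after = i , a≤i , m≤n⇒m≤1+n i<b , pi , after′
    where
    after′ : ∀ j → i < j → j < suc b → ¬ P j
    after′ j i<j (s≤s j≤b) with m≤n⇒m<n∨m≡n j≤b
    ... | inj₁ j<b  = after j i<j j<b
    ... | inj₂ refl = ¬pb

  first-witness-from : ∀ s d → P (s + d) →
    Σ ℕ λ i → s ≤ i × i ≤ s + d × P i × (∀ j → s ≤ j → j < i → ¬ P j)
  first-witness-from s zero ps =
    s , ≤-refl , m≤m+n s 0 , subst P (+-identityʳ s) ps , λ j s≤j j<s → ⊥-elim (<⇒≱ j<s s≤j)
  first-witness-from s (suc d) ps with P? s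
  ... | yes p = s , ≤-refl , m≤m+n s _ , p , λ j s≤j j<s → ⊥-elim (<⇒≱ j<s s≤j)
  ... | no ¬p with first-witness-from (suc s) d (subst P (+-suc s d) ps)
  ...   | i , s<i , i≤ , pi , before =
    i , <⇒≤ s<i , subst (i ≤_) (sym (+-suc s d)) i≤ , pi , before′
    where
    before′ : ∀ j → s ≤ j → j < i → ¬ P j
    before′ j s≤j j<i with m≤n⇒m<n∨m≡n s≤j
    ... | inj₁ s<j  = before j s<j j<i
    ... | inj₂ refl = ¬p

T-is-just : ∀ {X : Set} (m : Maybe X) → T (is-just m) → ∃ λ x → m ≡ just x
T-is-just (just x) _ = x , refl

update-≡ : ∀ {n} {X : Set} (f : Fin n → X) i x → update f i x i ≡ x
update-≡ f i x with i ≟F i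
... | yes _  = refl
... | no i≢i = ⊥-elim (i≢i refl)

update-≢ : ∀ {n} {X : Set} (f : Fin n → X) i x {j} → i ≢ j → update f i x j ≡ f j
update-≢ f i x {j} i≢j with i ≟F j
... | yes i≡j = ⊥-elim (i≢j i≡j)
... | no _    = refl

update-cong : ∀ {n} {X : Set} (f g : Fin n → X) i x y j →
              (i ≡ j → x ≡ y) → (i ≢ j → f j ≡ g j) → update f i x j ≡ update g i y j
update-cong f g i x y j at-i elsewhere with i ≟F j
... | yes i≡j = at-i i≡j
... | no i≢j  = elsewhere i≢j

Loc : ℕ → Set
Loc n = Fin n ⊎ Fin n

pattern state p    = inj₁ p
pattern register p = inj₂ p

owner : ∀ {n} → Loc n → Fin n
owner (state p)    = p
owner (register p) = p

_≟L_ : ∀ {n} → DecidableEquality (Loc n)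
_≟L_ = ≡-dec _≟F_ _≟F_

module _ {n : ℕ} (A : Algorithm n) where
  open Algorithm A
  open Config
  open import Data.List.Membership.DecPropositional (_≟L_ {n}) using (_∈?_)

  Outcome : Set
  Outcome = Config A × Maybe (Fin n → ℕ)

  AgreeOn : List (Loc n) → Config A → Config A → Set
  AgreeOn D c c′ = (∀ p → state p ∈ D → st c p ≡ st c′ p)
                 × (∀ p → register p ∈ D → reg c p ≡ reg c′ p)

  OutcomesAgreeOn : List (Loc n) → Fin n → Outcome → Outcome → Set
  OutcomesAgreeOn D p x y = AgreeOn D (proj₁ x) (proj₁ y) × (state p ∈ D → proj₂ x ≡ proj₂ y)

  Avoids : List (Loc n) → Fin n → Set
  Avoids D q = state q ∉ D × register q ∉ D

  perform : Config A → Fin n → Op n State Meta → Outcome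
  perform c p (rd j κ)   = record { st = update (st c) p (proj₁ (κ (reg c j))) ; reg = reg c }
                         , proj₂ (κ (reg c j))
  perform c p (wr m s o) = record { st = update (st c) p s
                                  ; reg = update (reg c) p (proj₁ (reg c p) , m) } , o

  apply-step : ∀ c p → apply A c (step p) ≡ perform c p (next p (st c p))
  apply-step c p with next p (st c p)
  ... | rd j κ   = refl
  ... | wr m s o = refl

  perform-st-≢ : ∀ c p o {r} → p ≢ r → st (proj₁ (perform c p o)) r ≡ st c r
  perform-st-≢ c p (rd j κ)   = update-≢ (st c) p _
  perform-st-≢ c p (wr m s o) = update-≢ (st c) p _

  perform-reg-≢ : ∀ c p o {r} → p ≢ r → reg (proj₁ (perform c p o)) r ≡ reg c r
  perform-reg-≢ c p (rd j κ)   _ = refl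
  perform-reg-≢ c p (wr m s o)   = update-≢ (reg c) p _

  perform-elsewhere : ∀ c c′ p o o′ {D} → Avoids D p → AgreeOn D c c′ →
                      AgreeOn D (proj₁ (perform c p o)) (proj₁ (perform c′ p o′))
  perform-elsewhere c c′ p o o′ (p∉ , p∉′) (agree-st , agree-reg) =
      (λ r r∈ → let p≢r = λ { refl → p∉ r∈ } in
        trans (perform-st-≢ c p o p≢r) (trans (agree-st r r∈) (sym (perform-st-≢ c′ p o′ p≢r))))
    , (λ r r∈ → let p≢r = λ { refl → p∉′ r∈ } in
        trans (perform-reg-≢ c p o p≢r) (trans (agree-reg r r∈) (sym (perform-reg-≢ c′ p o′ p≢r))))

  -- The locations before a step of p that determine the locations D after it; at most one is added.
  depsStep : ∀ {X Y : Set} → Dec X → Dec Y → Fin n → Op n State Meta → List (Loc n) → List (Loc n)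
  depsStep (yes _) _       p (rd j _)   D = register j ∷ D
  depsStep (yes _) _       p (wr _ _ _) D = D
  depsStep (no _)  (yes _) p _          D = state p ∷ D
  depsStep (no _)  (no _)  p _          D = D

  deps : Config A → Event n → List (Loc n) → List (Loc n)
  deps c (store p v) D = D
  deps c (step p)    D = depsStep (state p ∈? D) (register p ∈? D) p (next p (st c p)) D

  depsStep-⊇ : ∀ {X Y : Set} (d₁ : Dec X) (d₂ : Dec Y) p o D {x} → x ∈ D → x ∈ depsStep d₁ d₂ p o D
  depsStep-⊇ (yes _) _       p (rd j _)   D = there
  depsStep-⊇ (yes _) _       p (wr _ _ _) D = id
  depsStep-⊇ (no _)  (yes _) p _          D = there
  depsStep-⊇ (no _)  (no _)  p _          D = id

  deps-⊇ : ∀ c e D {x} → x ∈ D → x ∈ deps c e D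
  deps-⊇ c (store p v) D = id
  deps-⊇ c (step p)    D = depsStep-⊇ (state p ∈? D) (register p ∈? D) p (next p (st c p)) D

  deps-avoids : ∀ c e D {q} → Avoids (deps c e D) q → Avoids D q
  deps-avoids c e D (q∉ , q∉′) = q∉ ∘ deps-⊇ c e D , q∉′ ∘ deps-⊇ c e D

  length-depsStep : ∀ {X Y : Set} (d₁ : Dec X) (d₂ : Dec Y) p o D →
                    length (depsStep d₁ d₂ p o D) ≤ suc (length D)
  length-depsStep (yes _) _       p (rd j _)   D = ≤-refl
  length-depsStep (yes _) _       p (wr _ _ _) D = n≤1+n _
  length-depsStep (no _)  (yes _) p _          D = ≤-refl
  length-depsStep (no _)  (no _)  p _          D = n≤1+n _

  length-deps : ∀ c e D → length (deps c e D) ≤ suc (length D)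
  length-deps c (store p v) D = n≤1+n _
  length-deps c (step p)    D = length-depsStep (state p ∈? D) (register p ∈? D) p (next p (st c p)) D

  depsStep-sound : ∀ c c′ p D (d₁ : Dec (state p ∈ D)) (d₂ : Dec (register p ∈ D)) o o′ →
                   (st c p ≡ st c′ p → o ≡ o′) → AgreeOn (depsStep d₁ d₂ p o D) c c′ →
                   OutcomesAgreeOn D p (perform c p o) (perform c′ p o′)
  depsStep-sound c c′ p D (yes p∈) _ (rd j κ) o′ same-op (agree-st , agree-reg)
    with same-op (agree-st p (there p∈))
  ... | refl = ( (λ r r∈ → update-cong (st c) (st c′) p _ _ r (λ _ → cong (proj₁ ∘ κ) read-agrees)
                                                               (λ _ → agree-st r (there r∈)))
               , (λ r r∈ → agree-reg r (there r∈)) )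
             , λ _ → cong (proj₂ ∘ κ) read-agrees
    where read-agrees = agree-reg j (here refl)
  depsStep-sound c c′ p D (yes p∈) _ (wr m s o) o′ same-op (agree-st , agree-reg)
    with same-op (agree-st p p∈)
  ... | refl = ( (λ r r∈ → update-cong (st c) (st c′) p _ _ r (λ _ → refl) (λ _ → agree-st r r∈))
               , (λ r r∈ → update-cong (reg c) (reg c′) p _ _ r
                             (λ { refl → cong (λ z → proj₁ z , m) (agree-reg p r∈) })
                             (λ _ → agree-reg r r∈)) )
             , λ _ → refl
  depsStep-sound c c′ p D (no p∉) (yes _) (rd j κ) o′ same-op (agree-st , agree-reg)
    with same-op (agree-st p (here refl))
  ... | refl = ( (λ r r∈ → update-cong (st c) (st c′) p _ _ r (λ { refl → ⊥-elim (p∉ r∈) })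
                                                               (λ _ → agree-st r (there r∈)))
               , (λ r r∈ → agree-reg r (there r∈)) )
             , λ p∈ → ⊥-elim (p∉ p∈)
  depsStep-sound c c′ p D (no p∉) (yes _) (wr m s o) o′ same-op (agree-st , agree-reg)
    with same-op (agree-st p (here refl))
  ... | refl = ( (λ r r∈ → update-cong (st c) (st c′) p _ _ r (λ { refl → ⊥-elim (p∉ r∈) })
                                                               (λ _ → agree-st r (there r∈)))
               , (λ r r∈ → update-cong (reg c) (reg c′) p _ _ r
                             (λ { refl → cong (λ z → proj₁ z , m) (agree-reg p (there r∈)) })
                             (λ _ → agree-reg r (there r∈))) )
             , λ p∈ → ⊥-elim (p∉ p∈)
  depsStep-sound c c′ p D (no p∉) (no p∉′) o o′ _ agree =
    perform-elsewhere c c′ p o o′ (p∉ , p∉′) agree , λ p∈ → ⊥-elim (p∉ p∈)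

  redirect : Fin n → ℕ → Event n → Event n
  redirect q v (step p)    = step p
  redirect q v (store p w) = if isYes (p ≟F q) then store q v else store p w

  actor-redirect : ∀ q v e → actor (redirect q v e) ≡ actor e
  actor-redirect q v (step p)    = refl
  actor-redirect q v (store p w) with p ≟F q
  ... | yes p≡q = sym p≡q
  ... | no _    = refl

  redirect-sound : ∀ q v c c′ e D → Avoids D q → AgreeOn (deps c e D) c c′ →
                   OutcomesAgreeOn D (actor e) (apply A c e) (apply A c′ (redirect q v e))
  redirect-sound q v c c′ (store p w) D (q∉ , q∉′) (agree-st , agree-reg) with p ≟F q
  ... | yes refl =
        ( (λ r r∈ → update-cong (st c) (st c′) p _ _ r (λ { refl → ⊥-elim (q∉ r∈) }) (λ _ → agree-st r r∈))
        , (λ r r∈ → update-cong (reg c) (reg c′) p _ _ r (λ { refl → ⊥-elim (q∉′ r∈) }) (λ _ → agree-reg r r∈)) )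
      , λ _ → refl
  ... | no _ =
        ( (λ r r∈ → update-cong (st c) (st c′) p _ _ r
                      (λ { refl → cong (λ z → onStore p z w) (agree-st p r∈) }) (λ _ → agree-st r r∈))
        , (λ r r∈ → update-cong (reg c) (reg c′) p _ _ r
                      (λ { refl → cong (λ z → w , proj₂ z) (agree-reg p r∈) }) (λ _ → agree-reg r r∈)) )
      , λ _ → refl
  redirect-sound q v c c′ (step p) D _ agree rewrite apply-step c p | apply-step c′ p =
    depsStep-sound c c′ p D _ _ (next p (st c p)) (next p (st c′ p)) (cong (next p)) agree

  redirect-keeps-value : ∀ q v c e → proj₁ (reg c q) ≡ v →
                         proj₁ (reg (proj₁ (apply A c (redirect q v e))) q) ≡ v
  redirect-keeps-value q v c (store p w) holds with p ≟F q
  ... | yes refl = cong proj₁ (update-≡ (reg c) p _)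
  ... | no p≢q   = trans (cong proj₁ (update-≢ (reg c) p _ p≢q)) holds
  redirect-keeps-value q v c (step p) holds rewrite apply-step c p with next p (st c p)
  ... | rd j κ   = holds
  ... | wr m s o with p ≟F q
  ...   | yes refl = holds
  ...   | no _     = holds

  module _ (ex : Execution n) where
    open Execution ex using (initVal; sched)

    -- The locations of configuration i on which the state of p in configuration i + l depends.
    pastCone : Fin n → ℕ → ℕ → List (Loc n)
    pastCone p i zero    = state p ∷ []
    pastCone p i (suc l) = deps (config A ex i) (sched i) (pastCone p (suc i) l)

    length-pastCone : ∀ p i l → length (pastCone p i l) ≤ suc l
    length-pastCone p i zero    = ≤-refl
    length-pastCone p i (suc l) =
      ≤-trans (length-deps (config A ex i) (sched i) (pastCone p (suc i) l)) (s≤s (length-pastCone p (suc i) l))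

    state∈pastCone : ∀ p i l → state p ∈ pastCone p i l
    state∈pastCone p i zero    = here refl
    state∈pastCone p i (suc l) = deps-⊇ (config A ex i) (sched i) _ (state∈pastCone p (suc i) l)

    -- ex with a store of v into register q inserted at time f, and every later store of q
    -- turned into a store of v, so that q's register holds v from time f + 1 on.
    module Perturbation (q : Fin n) (v : ℕ) (f : ℕ) where

      sched′ : ℕ → Event n
      sched′ j with j <? f
      ... | yes _ = sched j
      ... | no _ with j ≟ f
      ...   | yes _ = store q v
      ...   | no _  = redirect q v (sched (pred j))

      sched′-< : ∀ j → j < f → sched′ j ≡ sched j
      sched′-< j j<f with j <? f
      ... | yes _   = refl
      ... | no j≮f  = ⊥-elim (j≮f j<f)

      sched′-≡ : sched′ f ≡ store q v
      sched′-≡ with f <? f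
      ... | yes f<f = ⊥-elim (<-irrefl refl f<f)
      ... | no _ with f ≟ f
      ...   | yes _ = refl
      ...   | no f≢f = ⊥-elim (f≢f refl)

      sched′-> : ∀ j → f ≤ j → sched′ (suc j) ≡ redirect q v (sched j)
      sched′-> j f≤j with suc j <? f
      ... | yes j<f = ⊥-elim (<⇒≱ j<f (m≤n⇒m≤1+n f≤j))
      ... | no _ with suc j ≟ f
      ...   | yes 1+j≡f = ⊥-elim (<⇒≱ (s≤s ≤-refl) (subst (_≤ j) (sym 1+j≡f) f≤j))
      ...   | no _      = refl

      ex′ : Execution n
      ex′ = record { initVal = initVal ; sched = sched′ }

      config-prefix : ∀ i → i ≤ f → config A ex′ i ≡ config A ex i
      config-prefix zero    _   = refl
      config-prefix (suc i) i<f =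
        cong₂ (λ c e → proj₁ (apply A c e)) (config-prefix i (<⇒≤ i<f)) (sched′-< i i<f)

      output-prefix : ∀ i → i < f → output A ex′ i ≡ output A ex i
      output-prefix i i<f = cong₂ (λ c e → proj₂ (apply A c e)) (config-prefix i (<⇒≤ i<f)) (sched′-< i i<f)

      config-inserted : config A ex′ (suc f) ≡ proj₁ (apply A (config A ex f) (store q v))
      config-inserted = cong₂ (λ c e → proj₁ (apply A c e)) (config-prefix f ≤-refl) sched′-≡

      value-perturbed : ∀ j → f ≤ j → value A ex′ (suc j) q ≡ v
      value-perturbed j f≤j with m≤n⇒m<n∨m≡n f≤j
      ... | inj₂ refl = trans (cong (λ c → proj₁ (Config.reg c q)) config-inserted)
                              (cong proj₁ (update-≡ (Config.reg (config A ex f)) q _))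
      value-perturbed (suc j) _ | inj₁ (s≤s f≤j) =
        subst (λ e → proj₁ (Config.reg (proj₁ (apply A (config A ex′ (suc j)) e)) q) ≡ v)
              (sym (sched′-> j f≤j))
              (redirect-keeps-value q v (config A ex′ (suc j)) (sched j) (value-perturbed j f≤j))

      agree-inserted : ∀ D → Avoids D q → AgreeOn D (config A ex f) (config A ex′ (suc f))
      agree-inserted D (q∉ , q∉′) = subst (AgreeOn D (config A ex f)) (sym config-inserted)
        ( (λ r r∈ → sym (update-≢ (Config.st (config A ex f)) q _ λ { refl → q∉ r∈ }))
        , (λ r r∈ → sym (update-≢ (Config.reg (config A ex f)) q _ λ { refl → q∉′ r∈ })) )

      agree-step : ∀ i → f ≤ i → ∀ D → Avoids D q →
                   AgreeOn (deps (config A ex i) (sched i) D) (config A ex i) (config A ex′ (suc i)) →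
                   OutcomesAgreeOn D (actor (sched i))
                     (apply A (config A ex i) (sched i)) (apply A (config A ex′ (suc i)) (sched′ (suc i)))
      agree-step i f≤i D avoids agree rewrite sched′-> i f≤i =
        redirect-sound q v _ _ (sched i) D avoids agree

      same-outputs : ∀ p l i → f ≤ i → Avoids (pastCone p i l) q →
                     AgreeOn (pastCone p i l) (config A ex i) (config A ex′ (suc i)) →
                     ∀ j → i ≤ j → j < i + l → actor (sched j) ≡ p → output A ex j ≡ output A ex′ (suc j)
      same-outputs p zero i _ _ _ j i≤j j<i+0 _ = ⊥-elim (<⇒≱ (subst (j <_) (+-identityʳ i) j<i+0) i≤j)
      same-outputs p (suc l) i f≤i avoids agree j i≤j j<i+l actor≡p with m≤n⇒m<n∨m≡n i≤j
      ... | inj₂ refl =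
        proj₂ (agree-step i f≤i _ (deps-avoids (config A ex i) (sched i) _ avoids) agree)
              (subst (λ r → state r ∈ pastCone p (suc i) l) (sym actor≡p) (state∈pastCone p (suc i) l))
      ... | inj₁ i<j =
        same-outputs p l (suc i) (m≤n⇒m≤1+n f≤i) (deps-avoids (config A ex i) (sched i) _ avoids)
          (proj₁ (agree-step i f≤i _ (deps-avoids (config A ex i) (sched i) _ avoids) agree))
          j i<j (subst (j <_) (+-suc i l) j<i+l) actor≡p

      module _ {p k out} (completes : Completes A ex p k out) (isStart : IsCollectStart A ex p f k)
               (avoids : Avoids (pastCone p f (suc (k ∸ f))) q) where

        actor-shifted : ∀ j → f ≤ j → actor (sched′ (suc j)) ≡ actor (sched j)
        actor-shifted j f≤j = trans (cong actor (sched′-> j f≤j)) (actor-redirect q v (sched j))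

        collect-outputs-kept : ∀ j → f ≤ j → j ≤ k → actor (sched j) ≡ p →
                               output A ex j ≡ output A ex′ (suc j)
        collect-outputs-kept j f≤j j≤k =
          same-outputs p (suc (k ∸ f)) f ≤-refl avoids (agree-inserted _ avoids) j f≤j
            (subst (j <_) (sym (trans (+-suc f (k ∸ f)) (cong suc (m+[n∸m]≡n (proj₁ isStart))))) (s≤s j≤k))

        perturbed-completes : Completes A ex′ p (suc k) out
        perturbed-completes =
            trans (actor-shifted k f≤k) (proj₁ completes)
          , trans (sym (collect-outputs-kept k f≤k ≤-refl (proj₁ completes))) (proj₂ completes)
          where f≤k = proj₁ isStart

        perturbed-collectStart : IsCollectStart A ex′ p (suc f) (suc k)
        perturbed-collectStart = shift isStart
          where
          shift : IsCollectStart A ex p f k → IsCollectStart A ex′ p (suc f) (suc k)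
          shift (f≤k , actor≡p , no-completion , earlier-completed) =
            s≤s f≤k , trans (actor-shifted f ≤-refl) actor≡p , no-completion′ , earlier-completed′
            where
            no-completion′ : ∀ i → suc f ≤ i → i < suc k → ∀ o → ¬ Completes A ex′ p i o
            no-completion′ (suc i) (s≤s f≤i) (s≤s i<k) o (actor≡p′ , output≡) =
              no-completion i f≤i i<k o (actor≡p″ , trans (collect-outputs-kept i f≤i (<⇒≤ i<k) actor≡p″) output≡)
              where actor≡p″ = trans (sym (actor-shifted i f≤i)) actor≡p′

            q≢p : q ≢ p
            q≢p refl = proj₁ avoids (state∈pastCone p f (suc (k ∸ f)))

            earlier-completed′ : ∀ j → j < suc f → actor (sched′ j) ≡ p →
                                 Σ ℕ λ i → j ≤ i × i < suc f × ∃ λ o → Completes A ex′ p i o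
            earlier-completed′ j (s≤s j≤f) actor≡p′ with m≤n⇒m<n∨m≡n j≤f
            ... | inj₂ refl = ⊥-elim (q≢p (trans (cong actor (sym sched′-≡)) actor≡p′))
            ... | inj₁ j<f with earlier-completed j j<f (trans (cong actor (sym (sched′-< j j<f))) actor≡p′)
            ...   | i , j≤i , i<f , o , actor≡p″ , output≡ =
              i , j≤i , m≤n⇒m≤1+n i<f , o ,
              trans (cong actor (sched′-< i i<f)) actor≡p″ , trans (output-prefix i i<f) output≡

    collect-sees-every-process : Correct A → ∀ {p k out f} →
                                 Completes A ex p k out → IsCollectStart A ex p f k →
                                 ∀ q → ¬ Avoids (pastCone p f (suc (k ∸ f))) q
    collect-sees-every-process correct {p} {k} {out} {f} completes isStart q avoids =
      stale (correct ex′ p (suc k) out (suc f) (perturbed-completes completes isStart avoids)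
                                               (perturbed-collectStart completes isStart avoids) q)
      where
      open Perturbation q (suc (out q)) f
      stale : ¬ (Σ ℕ λ τ → suc f ≤ τ × τ ≤ suc (suc k) × value A ex′ τ q ≡ out q)
      stale (suc τ , s≤s f≤τ , _ , fresh) = 1+n≢n (trans (sym (value-perturbed τ f≤τ)) fresh)

    collect-duration : Correct A → ∀ {p k out f} →
                       Completes A ex p k out → IsCollectStart A ex p f k → f + (n ∸ 1) ≤ suc k
    collect-duration correct {p} {k} {out} {f} completes isStart = begin
      f + (n ∸ 1)        ≤⟨ +-monoʳ-≤ f (∸-monoˡ-≤ 1 n≤length-cone) ⟩
      f + suc (k ∸ f)    ≡⟨ +-suc f (k ∸ f) ⟩
      suc (f + (k ∸ f))  ≡⟨ cong suc (m+[n∸m]≡n (proj₁ isStart)) ⟩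
      suc k              ∎
      where
      open ≤-Reasoning
      cone = pastCone p f (suc (k ∸ f))

      covered : ∀ q → q ∈ map owner cone
      covered q with state q ∈? cone | register q ∈? cone
      ... | yes q∈ | _      = ∈-map⁺ owner q∈
      ... | no _   | yes q∈ = ∈-map⁺ owner q∈
      ... | no q∉  | no q∉′ = ⊥-elim (collect-sees-every-process correct completes isStart q (q∉ , q∉′))

      n≤length-cone : n ≤ suc (suc (k ∸ f))
      n≤length-cone = begin
        n                       ≡⟨ length-tabulate id ⟨
        length (allFin n)       ≤⟨ length-≤-injectiveOn id (allFin⁺ n) (λ {q} _ → covered q) (λ _ _ → id) ⟩
        length (map owner cone) ≡⟨ length-map owner cone ⟩
        length cone             ≤⟨ length-pastCone p f (suc (k ∸ f)) ⟩
        suc (suc (k ∸ f))       ∎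

    Completion : Fin n → ℕ → Set
    Completion p i = ∃ (Completes A ex p i)

    completion? : ∀ p → Decidable (Completion p)
    completion? p i with actor (sched i) ≟F p | output A ex i
    ... | yes actor≡p | just o  = yes (o , actor≡p , refl)
    ... | yes _       | nothing = no λ { (_ , _ , ()) }
    ... | no actor≢p  | _       = no λ { (_ , actor≡p , _) → actor≢p actor≡p }

    completions-spaced : Correct A → ∀ {p a b} → a < b → Completion p a → Completion p b → a + (n ∸ 1) ≤ b
    completions-spaced correct {p} {a} {b} a<b completion-a (out , completes-b)
      with last-witness-below (completion? p) a<b completion-a
    ... | i , a≤i , i<b , completion-i , none-after
      with first-witness-from (λ j → actor (sched j) ≟F p) (suc i) (b ∸ suc i)
             (subst (λ j → actor (sched j) ≡ p) (sym (m+[n∸m]≡n i<b)) (proj₁ completes-b))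
    ...   | f , i<f , f≤ , actor≡p , none-before = s≤s⁻¹ (begin
      suc a + (n ∸ 1)  ≤⟨ +-monoˡ-≤ (n ∸ 1) (≤-trans (s≤s a≤i) i<f) ⟩
      f + (n ∸ 1)      ≤⟨ collect-duration correct completes-b isStart ⟩
      suc b            ∎)
      where
      open ≤-Reasoning

      earlier-completed : ∀ j → j < f → actor (sched j) ≡ p →
                          Σ ℕ λ i′ → j ≤ i′ × i′ < f × Completion p i′
      earlier-completed j j<f actor≡p′ with j ≤? i
      ... | yes j≤i = i , j≤i , i<f , completion-i
      ... | no j≰i  = ⊥-elim (none-before j (≰⇒> j≰i) j<f actor≡p′)

      isStart : IsCollectStart A ex p f b
      isStart = subst (f ≤_) (m+[n∸m]≡n i<b) f≤ , actor≡p
            , (λ j f≤j j<b o completes → none-after j (<-≤-trans i<f f≤j) j<b (o , completes))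
            , earlier-completed

  window-bounds : ∀ {lo hi x} → x ∈ window A lo hi → lo ≤ x × x < lo + (hi ∸ lo)
  window-bounds {lo} x∈ with ∈-map⁻ (lo +_) x∈
  ... | i , i∈ , refl = m≤m+n lo i , +-monoʳ-< lo (∈-upTo⁻ i∈)

  window-unique : ∀ lo hi → Unique (window A lo hi)
  window-unique lo hi = Unique.map⁺ (+-cancelˡ-≡ lo _ _) (upTo⁺ (hi ∸ lo))

  completedCount≤activeCount : Correct A → ∀ ex lo hi → hi ∸ lo ≤ n ∸ 1 →
                               completedCount A ex lo hi ≤ activeCount A ex lo hi
  completedCount≤activeCount correct ex lo hi short =
    length-≤-injectiveOn (actor ∘ sched) (filter⁺ (T? ∘ completes?) (window-unique lo hi))
                         actor-active actor-injective
    where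
    open Execution ex using (sched)

    completes? : ℕ → Bool
    completes? k = is-just (output A ex k)

    steps = window A lo hi

    completing : List ℕ
    completing = filterᵇ completes? steps

    in-window : ∀ {k} → k ∈ completing → k ∈ steps
    in-window = proj₁ ∘ ∈-filter⁻ (T? ∘ completes?) {xs = steps}

    completion : ∀ {k} → k ∈ completing → Completion ex (actor (sched k)) k
    completion {k} k∈ with T-is-just (output A ex k) (proj₂ (∈-filter⁻ (T? ∘ completes?) {xs = steps} k∈))
    ... | o , output≡ = o , refl , output≡

    not-twice : ∀ {a b} → a ∈ completing → b ∈ completing → a < b → actor (sched a) ≢ actor (sched b)
    not-twice {a} {b} a∈ b∈ a<b same-actor = <⇒≱ b<hi (begin
      lo + (hi ∸ lo)  ≤⟨ +-mono-≤ (proj₁ (window-bounds (in-window a∈))) short ⟩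
      a + (n ∸ 1)     ≤⟨ completions-spaced ex correct a<b (completion a∈)
                           (subst (λ p → Completion ex p b) (sym same-actor) (completion b∈)) ⟩
      b               ∎)
      where
      open ≤-Reasoning
      b<hi = proj₂ (window-bounds (in-window b∈))

    actor-injective : ∀ {a b} → a ∈ completing → b ∈ completing → actor (sched a) ≡ actor (sched b) → a ≡ b
    actor-injective {a} {b} a∈ b∈ same-actor with <-cmp a b
    ... | tri< a<b _ _ = ⊥-elim (not-twice a∈ b∈ a<b same-actor)
    ... | tri≈ _ a≡b _ = a≡b
    ... | tri> _ _ b<a = ⊥-elim (not-twice b∈ a∈ b<a (sym same-actor))

    active? : Fin n → Bool
    active? p = any (λ k → isYes (actor (sched k) ≟F p)) steps

    actor-active : ∀ {k} → k ∈ completing → actor (sched k) ∈ filterᵇ active? (allFin n)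
    actor-active {k} k∈ = ∈-filter⁺ (T? ∘ active?) (∈-allFin _)
                            (any⁺ _ (Any.map (λ { refl → fromWitness refl }) (in-window k∈)))

lemma3 : ∀ {n : ℕ} (A : Algorithm n) → Correct A →
         (ex : Execution n) (t₁ m : ℕ) →
         activeCount A ex t₁ (t₁ + (n ∸ 1)) ≡ m →
         completedCount A ex t₁ (t₁ + (n ∸ 1)) ≤ m
lemma3 {n} A correct ex t₁ m active≡m =
  subst (completedCount A ex t₁ (t₁ + (n ∸ 1)) ≤_) active≡m
        (completedCount≤activeCount A correct ex t₁ (t₁ + (n ∸ 1)) (≤-reflexive (m+n∸m≡n t₁ (n ∸ 1))))
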